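{- Define $\tau_0,\tau_1:\mathbb{Z}^2\to\mathbb{Z}^2$ by $\tau_0[a,b]=[a,a+b]$ and $\tau_1[a,b]=[b,a+b]$. For a binary code $\mathbf{c}=x_1x_2\cdots x_n$ with each $x_i\in\{0,1\}$, set $T[\mathbf{c}]=\tau_{x_n}\tau_{x_{n-1}}\cdots\tau_{x_1}[1,2]$, so that $\tau_{x_1}$ is applied first. Let $\|[a,b]\|=|a|+|b|$. Then for every integer $j\ge 2$, \[\|T[0^j1^j]\|=\|T[1^j0^j]\|<\|T[(01)^j]\|=\|T[(10)^j]\|.\] Here $0^j1^j$ is the code consisting of $j$ zeros followed by $j$ ones, $1^j0^j$ is $j$ ones followed by $j$ zeros, and $(01)^j$ and $(10)^j$ are the alternating codes $0101\cdots01$ and $1010\cdots10$ of length $2j$. -}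

module Defs where

open import Data.Bool using (Bool; true; false)
open import Data.Integer using (ℤ; +_; _+_; ∣_∣)
open import Data.Nat using (ℕ) renaming (_+_ to _+ℕ_)
open import Data.List using (List; []; _∷_; _++_; replicate; concat; foldl)
open import Data.Product using (_×_; _,_)

-- A binary digit: false = 0, true = 1.
Code : Set
Code = List Bool

τ : Bool → ℤ × ℤ → ℤ × ℤ
τ false (a , b) = (a , a + b)
τ true  (a , b) = (b , a + b)

T : Code → ℤ × ℤ
T c = foldl (λ v x → τ x v) (+ 1 , + 2) c

‖_‖ : ℤ × ℤ → ℕ
‖ (a , b) ‖ = ∣ a ∣ +ℕ ∣ b ∣

_^ᶜ_ : Code → ℕ → Code
c ^ᶜ j = concat (replicate j c)

{-# OPTIONS --safe #-}
-- Every T[c] has nonnegative entries, so we compute with τ on ℕ².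
-- τ₁ shifts the consecutive pair of any Fibonacci-type sequence, which gives
-- closed forms for T[0ᵏ1ᵏ] and T[1ᵏ0ᵏ] in Fibonacci numbers with equal sums.
-- Along the alternating codes, T[(01)ᵏ] = [x,y] and T[(10)ᵏ] = [u,v] keep
-- y = 2u and v = x + u, hence equal sums. Finally τ₁τ₀ T[0ᵏ1ᵏ] equals
-- T[0ᵏ⁺¹1ᵏ⁺¹] plus the gap ((k+1)Fₖ, kFₖ); by monotonicity of the τ's this
-- gives T[0ᵏ1ᵏ] ≤ T[(01)ᵏ] componentwise, and the gap is nonzero once k ≥ 1.
module Submission where

open import Defs
open import Data.Bool using (Bool; true; false)
open import Data.Integer using (ℤ; +_)
open import Data.List using ([]; _∷_; _++_; foldl)
open import Data.List.Properties using (foldl-++; ++-identityʳ)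
open import Data.Nat using (ℕ; zero; suc; _+_; _*_; _≤_; _<_; s≤s; z≤n)
open import Data.Nat.Properties
  using (≤-refl; ≤-trans; <-≤-trans; +-mono-≤; m≤m+n; m≤n+m; m<m+n; *-zeroʳ; module ≤-Reasoning)
open import Data.Nat.Tactic.RingSolver using (solve-∀)
open import Data.Product using (_×_; _,_)
open import Data.Product.Relation.Binary.Pointwise.NonDependent using (Pointwise)
open import Relation.Binary.PropositionalEquality
  using (_≡_; refl; sym; trans; cong; cong₂; subst; module ≡-Reasoning)

ℕ² : Set
ℕ² = ℕ × ℕ

_⊕_ : ℕ² → ℕ² → ℕ²
(a , b) ⊕ (c , d) = (a + c , b + d)

size : ℕ² → ℕ
size (a , b) = a + b

_≤²_ : ℕ² → ℕ² → Set
_≤²_ = Pointwise _≤_ _≤_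

≤²-trans : ∀ {u v w} → u ≤² v → v ≤² w → u ≤² w
≤²-trans (a≤b , c≤d) (b≤e , d≤f) = ≤-trans a≤b b≤e , ≤-trans c≤d d≤f

≤²-⊕ : ∀ u d → u ≤² (u ⊕ d)
≤²-⊕ (a , b) (c , d) = m≤m+n a c , m≤m+n b d

size-⊕ : ∀ u v → size (u ⊕ v) ≡ size u + size v
size-⊕ (a , b) (c , d) = interchange a c b d
  where
  interchange : ∀ a c b d → (a + c) + (b + d) ≡ (a + b) + (c + d)
  interchange = solve-∀

size-mono : ∀ {u v} → u ≤² v → size u ≤ size v
size-mono (a≤c , b≤d) = +-mono-≤ a≤c b≤d

τℕ : Bool → ℕ² → ℕ²
τℕ false (a , b) = (a , a + b)
τℕ true  (a , b) = (b , a + b)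

run : Code → ℕ² → ℕ²
run c v = foldl (λ w x → τℕ x w) v c

τℕ-mono : ∀ x {u v} → u ≤² v → τℕ x u ≤² τℕ x v
τℕ-mono false (a≤c , b≤d) = a≤c , +-mono-≤ a≤c b≤d
τℕ-mono true  (a≤c , b≤d) = b≤d , +-mono-≤ a≤c b≤d

run-mono : ∀ c {u v} → u ≤² v → run c u ≤² run c v
run-mono []      u≤v = u≤v
run-mono (x ∷ c) u≤v = run-mono c (τℕ-mono x u≤v)

run-++ : ∀ c d v → run (c ++ d) v ≡ run d (run c v)
run-++ c d v = foldl-++ (λ w x → τℕ x w) v c d

run-^ᶜ-suc : ∀ c k v → run (c ^ᶜ suc k) v ≡ run c (run (c ^ᶜ k) v)
run-^ᶜ-suc c zero    v = cong (λ d → run d v) (++-identityʳ c)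
run-^ᶜ-suc c (suc k) v = begin
  run (c ^ᶜ suc (suc k)) v       ≡⟨ run-++ c (c ^ᶜ suc k) v ⟩
  run (c ^ᶜ suc k) (run c v)     ≡⟨ run-^ᶜ-suc c k (run c v) ⟩
  run c (run (c ^ᶜ k) (run c v)) ≡⟨ cong (run c) (sym (run-++ c (c ^ᶜ k) v)) ⟩
  run c (run (c ^ᶜ suc k) v)     ∎
  where open ≡-Reasoning

toℤ² : ℕ² → ℤ × ℤ
toℤ² (a , b) = (+ a , + b)

foldl-τ-toℤ² : ∀ c v → foldl (λ w x → τ x w) (toℤ² v) c ≡ toℤ² (run c v)
foldl-τ-toℤ² []          v       = refl
foldl-τ-toℤ² (false ∷ c) (a , b) = foldl-τ-toℤ² c (a , a + b)
foldl-τ-toℤ² (true  ∷ c) (a , b) = foldl-τ-toℤ² c (b , a + b)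

‖T‖≡size-run : ∀ c → ‖ T c ‖ ≡ size (run c (1 , 2))
‖T‖≡size-run c = cong ‖_‖ (foldl-τ-toℤ² c (1 , 2))

fib : ℕ → ℕ
fib zero          = 0
fib (suc zero)    = 1
fib (suc (suc n)) = fib n + fib (suc n)

0<fib-suc : ∀ n → 0 < fib (suc n)
0<fib-suc zero    = s≤s z≤n
0<fib-suc (suc n) = <-≤-trans (0<fib-suc n) (m≤n+m (fib (suc n)) (fib n))

FibLike : (ℕ → ℕ) → Set
FibLike G = ∀ n → G (suc (suc n)) ≡ G n + G (suc n)

zeros ones : ℕ → Code
zeros j = (false ∷ []) ^ᶜ j
ones  j = (true  ∷ []) ^ᶜ j

zero-one one-zero : Code
zero-one = false ∷ true ∷ []
one-zero = true ∷ false ∷ []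

run-zeros : ∀ j a b → run (zeros j) (a , b) ≡ (a , j * a + b)
run-zeros zero    a b = refl
run-zeros (suc j) a b = trans (run-zeros j a (a + b)) (cong (a ,_) (reassoc j a b))
  where
  reassoc : ∀ j a b → j * a + (a + b) ≡ (a + j * a) + b
  reassoc = solve-∀

run-ones : ∀ {G} → FibLike G → ∀ j → run (ones j) (G 0 , G 1) ≡ (G j , G (suc j))
run-ones         G-fib zero    = refl
run-ones {G = G} G-fib (suc j) =
  trans (cong (λ b → run (ones j) (G 1 , b)) (sym (G-fib 0)))
        (run-ones {λ n → G (suc n)} (λ n → G-fib (suc n)) j)

-- The Fibonacci-type sequence starting 1, k+2 (= T[0ᵏ]); its terms k and k+1 form T[0ᵏ1ᵏ].
blockSeq : ℕ → ℕ → ℕ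
blockSeq k n = k * fib n + fib (2 + n)

blockSeq-fibLike : ∀ k → FibLike (blockSeq k)
blockSeq-fibLike k n = distrib k (fib n) (fib (suc n)) (fib (2 + n)) (fib (3 + n))
  where
  distrib : ∀ k p q r s → k * (p + q) + (r + s) ≡ (k * p + r) + (k * q + s)
  distrib = solve-∀

block : ℕ → ℕ²
block k = (blockSeq k k , blockSeq k (suc k))

run-zeros-ones : ∀ k → run (zeros k ++ ones k) (1 , 2) ≡ block k
run-zeros-ones k = begin
  run (zeros k ++ ones k) (1 , 2)            ≡⟨ run-++ (zeros k) (ones k) (1 , 2) ⟩
  run (ones k) (run (zeros k) (1 , 2))       ≡⟨ cong (run (ones k)) (run-zeros k 1 2) ⟩
  run (ones k) (1 , k * 1 + 2)               ≡⟨ cong (λ a → run (ones k) (a + 1 , k * 1 + 2)) (sym (*-zeroʳ k)) ⟩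
  run (ones k) (blockSeq k 0 , blockSeq k 1) ≡⟨ run-ones {blockSeq k} (blockSeq-fibLike k) k ⟩
  block k                                    ∎
  where open ≡-Reasoning

run-ones-zeros : ∀ k → run (ones k ++ zeros k) (1 , 2) ≡ (fib (2 + k) , k * fib (2 + k) + fib (3 + k))
run-ones-zeros k = begin
  run (ones k ++ zeros k) (1 , 2)               ≡⟨ run-++ (ones k) (zeros k) (1 , 2) ⟩
  run (zeros k) (run (ones k) (1 , 2))          ≡⟨ cong (run (zeros k)) (run-ones {λ n → fib (2 + n)} (λ _ → refl) k) ⟩
  run (zeros k) (fib (2 + k) , fib (3 + k))     ≡⟨ run-zeros k (fib (2 + k)) (fib (3 + k)) ⟩
  (fib (2 + k) , k * fib (2 + k) + fib (3 + k)) ∎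
  where open ≡-Reasoning

‖T-zeros-ones‖≡‖T-ones-zeros‖ : ∀ k → ‖ T (zeros k ++ ones k) ‖ ≡ ‖ T (ones k ++ zeros k) ‖
‖T-zeros-ones‖≡‖T-ones-zeros‖ k = begin
  ‖ T (zeros k ++ ones k) ‖                          ≡⟨ ‖T‖≡size-run (zeros k ++ ones k) ⟩
  size (run (zeros k ++ ones k) (1 , 2))             ≡⟨ cong size (run-zeros-ones k) ⟩
  size (block k)                                     ≡⟨ regroup k (fib k) (fib (suc k)) ⟩
  size (fib (2 + k) , k * fib (2 + k) + fib (3 + k)) ≡⟨ cong size (sym (run-ones-zeros k)) ⟩
  size (run (ones k ++ zeros k) (1 , 2))             ≡⟨ sym (‖T‖≡size-run (ones k ++ zeros k)) ⟩
  ‖ T (ones k ++ zeros k) ‖                          ∎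
  where
  open ≡-Reasoning
  regroup : ∀ k p q → (k * p + (p + q)) + (k * q + (q + (p + q)))
                    ≡ (p + q) + (k * (p + q) + (q + (p + q)))
  regroup = solve-∀

Twin : ℕ² → ℕ² → Set
Twin (x , y) (u , v) = (y ≡ u + u) × (x + u ≡ v)

Twin-step : ∀ {p q} → Twin p q → Twin (run zero-one p) (run one-zero q)
Twin-step {x , _} {u , _} (refl , refl) = double x u , shift x u
  where
  double : ∀ x u → x + (x + (u + u)) ≡ (x + u) + (x + u)
  double = solve-∀
  shift : ∀ x u → (x + (u + u)) + (x + u) ≡ (x + u) + (u + (x + u))
  shift = solve-∀

Twin-run : ∀ k {p q} → Twin p q → Twin (run (zero-one ^ᶜ k) p) (run (one-zero ^ᶜ k) q)
Twin-run zero    t = t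
Twin-run (suc k) t = Twin-run k (Twin-step t)

Twin-size : ∀ {p q} → Twin p q → size p ≡ size q
Twin-size {x , _} {u , _} (refl , refl) = regroup x u
  where
  regroup : ∀ x u → x + (u + u) ≡ u + (x + u)
  regroup = solve-∀

‖T-zero-one^ᶜ‖≡‖T-one-zero^ᶜ‖ : ∀ k → ‖ T (zero-one ^ᶜ k) ‖ ≡ ‖ T (one-zero ^ᶜ k) ‖
‖T-zero-one^ᶜ‖≡‖T-one-zero^ᶜ‖ k = begin
  ‖ T (zero-one ^ᶜ k) ‖              ≡⟨ ‖T‖≡size-run (zero-one ^ᶜ k) ⟩
  size (run (zero-one ^ᶜ k) (1 , 2)) ≡⟨ Twin-size (Twin-run k (refl , refl)) ⟩
  size (run (one-zero ^ᶜ k) (1 , 2)) ≡⟨ sym (‖T‖≡size-run (one-zero ^ᶜ k)) ⟩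
  ‖ T (one-zero ^ᶜ k) ‖              ∎
  where open ≡-Reasoning

run-zero-one-block : ∀ k → run zero-one (block k) ≡ block (suc k) ⊕ (suc k * fib k , k * fib k)
run-zero-one-block k = cong₂ _,_ (first k (fib k) (fib (suc k))) (second k (fib k) (fib (suc k)))
  where
  first : ∀ k p q → (k * p + (p + q)) + (k * q + (q + (p + q)))
                  ≡ (suc k * q + (q + (p + q))) + suc k * p
  first = solve-∀
  second : ∀ k p q → (k * p + (p + q)) + ((k * p + (p + q)) + (k * q + (q + (p + q))))
                   ≡ (suc k * (p + q) + ((p + q) + (q + (p + q)))) + k * p
  second = solve-∀

block-suc≤²run-zero-one-block : ∀ k → block (suc k) ≤² run zero-one (block k)
block-suc≤²run-zero-one-block k = subst (block (suc k) ≤²_) (sym (run-zero-one-block k)) (≤²-⊕ _ _)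

block≤²run-zero-one^ᶜ : ∀ k → block k ≤² run (zero-one ^ᶜ k) (1 , 2)
block≤²run-zero-one^ᶜ zero    = ≤-refl , ≤-refl
block≤²run-zero-one^ᶜ (suc k) =
  subst (block (suc k) ≤²_) (sym (run-^ᶜ-suc zero-one k (1 , 2)))
        (≤²-trans (block-suc≤²run-zero-one-block k) (run-mono zero-one (block≤²run-zero-one^ᶜ k)))

size-block<size-run-zero-one^ᶜ : ∀ m → size (block (2 + m)) < size (run (zero-one ^ᶜ (2 + m)) (1 , 2))
size-block<size-run-zero-one^ᶜ m = begin-strict
  size (block (2 + m))                                  <⟨ m<m+n _ gap>0 ⟩
  size (block (2 + m)) + size gap                       ≡⟨ sym (size-⊕ (block (2 + m)) gap) ⟩
  size (block (2 + m) ⊕ gap)                            ≡⟨ cong size (sym (run-zero-one-block (suc m))) ⟩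
  size (run zero-one (block (suc m)))                   ≤⟨ size-mono (run-mono zero-one (block≤²run-zero-one^ᶜ (suc m))) ⟩
  size (run zero-one (run (zero-one ^ᶜ suc m) (1 , 2))) ≡⟨ cong size (sym (run-^ᶜ-suc zero-one (suc m) (1 , 2))) ⟩
  size (run (zero-one ^ᶜ (2 + m)) (1 , 2))              ∎
  where
  open ≤-Reasoning
  gap : ℕ²
  gap = (2 + m) * fib (suc m) , suc m * fib (suc m)
  gap>0 : 0 < size gap
  gap>0 = <-≤-trans (0<fib-suc m) (≤-trans (m≤m+n _ _) (m≤m+n _ _))

‖T-ones-zeros‖<‖T-zero-one^ᶜ‖ : ∀ m → ‖ T (ones (2 + m) ++ zeros (2 + m)) ‖ < ‖ T (zero-one ^ᶜ (2 + m)) ‖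
‖T-ones-zeros‖<‖T-zero-one^ᶜ‖ m = begin-strict
  ‖ T (ones k ++ zeros k) ‖              ≡⟨ sym (‖T-zeros-ones‖≡‖T-ones-zeros‖ k) ⟩
  ‖ T (zeros k ++ ones k) ‖              ≡⟨ ‖T‖≡size-run (zeros k ++ ones k) ⟩
  size (run (zeros k ++ ones k) (1 , 2)) ≡⟨ cong size (run-zeros-ones k) ⟩
  size (block k)                         <⟨ size-block<size-run-zero-one^ᶜ m ⟩
  size (run (zero-one ^ᶜ k) (1 , 2))     ≡⟨ sym (‖T‖≡size-run (zero-one ^ᶜ k)) ⟩
  ‖ T (zero-one ^ᶜ k) ‖                  ∎
  where
  open ≤-Reasoning
  k = 2 + m

proposition3p5 : (j : ℕ) → 2 ≤ j →
    (‖ T (((false ∷ []) ^ᶜ j) ++ ((true ∷ []) ^ᶜ j)) ‖ ≡ ‖ T (((true ∷ []) ^ᶜ j) ++ ((false ∷ []) ^ᶜ j)) ‖)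
    × (‖ T (((true ∷ []) ^ᶜ j) ++ ((false ∷ []) ^ᶜ j)) ‖ < ‖ T ((false ∷ true ∷ []) ^ᶜ j) ‖)
    × (‖ T ((false ∷ true ∷ []) ^ᶜ j) ‖ ≡ ‖ T ((true ∷ false ∷ []) ^ᶜ j) ‖)
proposition3p5 (suc (suc m)) (s≤s (s≤s z≤n)) =
  ‖T-zeros-ones‖≡‖T-ones-zeros‖ (2 + m) , ‖T-ones-zeros‖<‖T-zero-one^ᶜ‖ m , ‖T-zero-one^ᶜ‖≡‖T-one-zero^ᶜ‖ (2 + m)
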